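{- For all $n\ge 0$ and $q\ge 1$, if $\mathcal{W}^q_n$ denotes the set of $q$-decreasing binary words of length $n$, and $E$ (resp. $O$) denotes the number of words in $\mathcal{W}^q_n$ with an even (resp. odd) number of letters $1$, then $E-O\in\{ -1,0,1\}$.
   Context: A binary word is $q$-decreasing ($q\ge1$) if each of its maximal factors (maximal blocks of consecutive letters) of the form $0^a1^b$ with $a>0$ satisfies $q\cdot a>b$. -}

module Defs where

open import Data.Bool using (Bool; true; false; _∧_; T)
open import Data.Nat using (ℕ; zero; suc; _*_; _<ᵇ_; _<_)
open import Data.List using (List; []; _∷_; filter; length)
open import Data.Vec using (Vec; toList; []; _∷_)
open import Data.Bool.Properties using (T?)
open import Data.Product using (_×_; _,_)

-- Binary letters: false = letter 0, true = letter 1.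

-- Maximal-factor check, by a left-to-right scan of the word.
--   leading  : scanning outside any factor 0^a 1^b (before the first 0,
--              i.e. inside a leading run of 1s)
--   zeros a  : inside the 0-run of a factor, a zeros read so far
--   ones a b : inside the 1-run of a factor with a zeros, b ones so far
-- A factor 0^a 1^b (a > 0) is maximal exactly when its 0-run is a maximal
-- run of 0s and its 1-run is the maximal run of 1s that follows it (b = 0
-- if the 0-run ends the word).
mutual
  leading : ℕ → List Bool → Bool
  leading q []          = true
  leading q (true ∷ w)  = leading q w
  leading q (false ∷ w) = zeros q 1 w

  zeros : ℕ → ℕ → List Bool → Bool
  zeros q a []          = 0 <ᵇ q * a
  zeros q a (false ∷ w) = zeros q (suc a) w
  zeros q a (true ∷ w)  = ones q a 1 w

  ones : ℕ → ℕ → ℕ → List Bool → Bool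
  ones q a b []          = b <ᵇ q * a
  ones q a b (true ∷ w)  = ones q a (suc b) w
  ones q a b (false ∷ w) = (b <ᵇ q * a) ∧ zeros q 1 w

qDecreasing : ℕ → List Bool → Set
qDecreasing q w = T (leading q w)

words : (n : ℕ) → List (Vec Bool n)
words zero    = [] ∷ []
words (suc n) = Data.List.map (false ∷_) (words n) Data.List.++ Data.List.map (true ∷_) (words n)

W : ℕ → (n : ℕ) → List (Vec Bool n)
W q n = filter (λ v → T? (leading q (toList v))) (words n)

ones# : List Bool → ℕ
ones# w = length (filter (λ x → T? x) w)

isEven : ℕ → Bool
isEven zero          = true
isEven (suc zero)    = false
isEven (suc (suc n)) = isEven n

E : ℕ → ℕ → ℕ
E q n = length (filter (λ v → T? (isEven (ones# (toList v)))) (W q n))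

O : ℕ → ℕ → ℕ
O q n = length (filter (λ v → T? (Data.Bool.not (isEven (ones# (toList v))))) (W q n))

-- For the words accepted from a given state, the signed count Σ (-1)^(number of 1s)
-- over words of length n+1 is the count from the 0-successor minus the count from
-- the 1-successor.  This recursion is solved in closed form by the signed pulse
-- trains ρ_k of period q+2 started at time k: from a 0-run with budget c = q·a the
-- count is ρ_0 − ρ_c, from a 1-run with remaining budget c = q·a − b it is
-- (ρ_0 + ρ_{q+1}) − (ρ_c + ρ_{c+q+1}), and from the start state it is ρ_0 + ρ_{q+1}.
-- As 0 and q+1 differ modulo q+2, at most one of these two pulses is nonzero at any
-- time, so E − O ∈ {−1, 0, 1}.
module Submission where

open import Defs
open import Data.Nat using (ℕ; _≥_)
open import Data.Integer using (ℤ; +_; -[1+_]; _-_)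
open import Data.Sum using (_⊎_)
open import Relation.Binary.PropositionalEquality using (_≡_)

open import Data.Bool using (Bool; true; false; not; _∧_; if_then_else_)
open import Data.Bool.Properties using (T?; T-≡; not-involutive)
open import Data.Empty using (⊥-elim)
open import Data.Integer using (0ℤ; 1ℤ; -_; _+_; ∣_∣)
import Data.Integer.Properties as ℤₚ
open import Data.Integer.Tactic.RingSolver using (solve-∀)
open import Data.List using (List; []; _∷_; _++_; map; length; filterᵇ)
open import Data.List.Properties using (filter-++; length-++; length-map)
open import Data.Nat using (zero; suc; _*_; _<ᵇ_; _≤_; _<_; z≤n; s≤s; z<s)
import Data.Nat as ℕ
import Data.Nat.Properties as ℕₚ
open import Data.Sum using (inj₁; inj₂)
open import Data.Vec using (Vec; []; _∷_; toList)
open import Function using (_∘_; Equivalence)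
open import Relation.Binary.PropositionalEquality
  using (_≢_; refl; sym; trans; cong; cong₂; subst; module ≡-Reasoning)

open ≡-Reasoning

private
  variable
    A B : Set
    n : ℕ

filterᵇ-map : ∀ (p : B → Bool) (f : A → B) xs → filterᵇ p (map f xs) ≡ map f (filterᵇ (p ∘ f) xs)
filterᵇ-map p f []       = refl
filterᵇ-map p f (x ∷ xs) with p (f x)
... | true  = cong (f x ∷_) (filterᵇ-map p f xs)
... | false = filterᵇ-map p f xs

filterᵇ-cong : ∀ {p p′ : A → Bool} → (∀ x → p x ≡ p′ x) → ∀ xs → filterᵇ p xs ≡ filterᵇ p′ xs
filterᵇ-cong {p = p} {p′} p≗p′ []       = refl
filterᵇ-cong {p = p} {p′} p≗p′ (x ∷ xs) with p x | p′ x | p≗p′ x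
... | true  | true  | _ = cong (x ∷_) (filterᵇ-cong p≗p′ xs)
... | false | false | _ = filterᵇ-cong p≗p′ xs

count : (A → Bool) → List A → ℕ
count p xs = length (filterᵇ p xs)

count-++ : ∀ (p : A → Bool) xs ys → count p (xs ++ ys) ≡ count p xs ℕ.+ count p ys
count-++ p xs ys = trans (cong length (filter-++ (T? ∘ p) xs ys)) (length-++ (filterᵇ p xs))

count-map : ∀ (p : B → Bool) (f : A → B) xs → count p (map f xs) ≡ count (p ∘ f) xs
count-map p f xs = trans (cong length (filterᵇ-map p f xs)) (length-map f (filterᵇ (p ∘ f) xs))

count-cong : ∀ {p p′ : A → Bool} → (∀ x → p x ≡ p′ x) → ∀ xs → count p xs ≡ count p′ xs
count-cong p≗p′ xs = cong length (filterᵇ-cong p≗p′ xs)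

isEven-suc : ∀ m → isEven (suc m) ≡ not (isEven m)
isEven-suc zero          = refl
isEven-suc (suc zero)    = refl
isEven-suc (suc (suc m)) = isEven-suc m

evenOnes : List Bool → Bool
evenOnes w = isEven (ones# w)

balance : List (Vec Bool n) → ℤ
balance vs = + count (evenOnes ∘ toList) vs - + count (not ∘ evenOnes ∘ toList) vs

balance-++ : (us vs : List (Vec Bool n)) → balance (us ++ vs) ≡ balance us + balance vs
balance-++ us vs = begin
  + e (us ++ vs) - + o (us ++ vs)
    ≡⟨ cong₂ _-_ (cong +_ (count-++ _ us vs)) (cong +_ (count-++ _ us vs)) ⟩
  + (e us ℕ.+ e vs) - + (o us ℕ.+ o vs)
    ≡⟨ cong₂ _-_ (ℤₚ.pos-+ (e us) (e vs)) (ℤₚ.pos-+ (o us) (o vs)) ⟩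
  (+ e us + + e vs) - (+ o us + + o vs)
    ≡⟨ interchange (+ e us) (+ e vs) (+ o us) (+ o vs) ⟩
  (+ e us - + o us) + (+ e vs - + o vs) ∎
  where
  e o : List (Vec Bool _) → ℕ
  e ws = count (evenOnes ∘ toList) ws
  o ws = count (not ∘ evenOnes ∘ toList) ws
  interchange : ∀ a b c d → (a + b) - (c + d) ≡ (a - c) + (b - d)
  interchange = solve-∀

balance-map-false : (vs : List (Vec Bool n)) → balance (map (false ∷_) vs) ≡ balance vs
balance-map-false vs = cong₂ _-_
  (cong +_ (count-map (evenOnes ∘ toList) (false ∷_) vs))
  (cong +_ (count-map (not ∘ evenOnes ∘ toList) (false ∷_) vs))

balance-map-true : (vs : List (Vec Bool n)) → balance (map (true ∷_) vs) ≡ - balance vs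
balance-map-true vs = begin
  + count (evenOnes ∘ toList) (map (true ∷_) vs) - + count (not ∘ evenOnes ∘ toList) (map (true ∷_) vs)
    ≡⟨ cong₂ _-_ (cong +_ (trans (count-map _ (true ∷_) vs) (count-cong flip vs)))
                 (cong +_ (trans (count-map _ (true ∷_) vs) (count-cong flip² vs))) ⟩
  + count (not ∘ evenOnes ∘ toList) vs - + count (evenOnes ∘ toList) vs
    ≡⟨ swap (+ count (evenOnes ∘ toList) vs) (+ count (not ∘ evenOnes ∘ toList) vs) ⟩
  - balance vs ∎
  where
  flip : (v : Vec Bool _) → evenOnes (true ∷ toList v) ≡ not (evenOnes (toList v))
  flip v = isEven-suc (ones# (toList v))
  flip² : (v : Vec Bool _) → not (evenOnes (true ∷ toList v)) ≡ evenOnes (toList v)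
  flip² v = trans (cong not (flip v)) (not-involutive _)
  swap : ∀ x y → y - x ≡ - (x - y)
  swap = solve-∀

filterᵇ-words : ∀ (g : List Bool → Bool) n → filterᵇ (g ∘ toList) (words (suc n)) ≡
  map (false ∷_) (filterᵇ (g ∘ (false ∷_) ∘ toList) (words n)) ++
  map (true ∷_) (filterᵇ (g ∘ (true ∷_) ∘ toList) (words n))
filterᵇ-words g n = begin
  filterᵇ (g ∘ toList) (map (false ∷_) (words n) ++ map (true ∷_) (words n))
    ≡⟨ filter-++ (T? ∘ g ∘ toList) (map (false ∷_) (words n)) (map (true ∷_) (words n)) ⟩
  filterᵇ (g ∘ toList) (map (false ∷_) (words n)) ++ filterᵇ (g ∘ toList) (map (true ∷_) (words n))
    ≡⟨ cong₂ _++_ (filterᵇ-map (g ∘ toList) (false ∷_) (words n))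
                  (filterᵇ-map (g ∘ toList) (true ∷_) (words n)) ⟩
  map (false ∷_) (filterᵇ (g ∘ (false ∷_) ∘ toList) (words n)) ++
  map (true ∷_) (filterᵇ (g ∘ (true ∷_) ∘ toList) (words n)) ∎

-- Σ (-1)^(number of 1s in w) over the binary words w of length n with g w.
signedCount : (List Bool → Bool) → ℕ → ℤ
signedCount g zero    = if g [] then 1ℤ else 0ℤ
signedCount g (suc n) = signedCount (g ∘ (false ∷_)) n - signedCount (g ∘ (true ∷_)) n

signedCount≡balance : ∀ g n → signedCount g n ≡ balance (filterᵇ (g ∘ toList) (words n))
signedCount≡balance g zero with g []
... | true  = refl
... | false = refl
signedCount≡balance g (suc n) = begin
  signedCount (g ∘ (false ∷_)) n - signedCount (g ∘ (true ∷_)) n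
    ≡⟨ cong₂ _-_ (signedCount≡balance (g ∘ (false ∷_)) n) (signedCount≡balance (g ∘ (true ∷_)) n) ⟩
  balance ws₀ - balance ws₁
    ≡⟨ cong₂ _+_ (sym (balance-map-false ws₀)) (sym (balance-map-true ws₁)) ⟩
  balance (map (false ∷_) ws₀) + balance (map (true ∷_) ws₁)
    ≡⟨ sym (balance-++ (map (false ∷_) ws₀) (map (true ∷_) ws₁)) ⟩
  balance (map (false ∷_) ws₀ ++ map (true ∷_) ws₁)
    ≡⟨ cong balance (sym (filterᵇ-words g n)) ⟩
  balance (filterᵇ (g ∘ toList) (words (suc n))) ∎
  where
  ws₀ ws₁ : List (Vec Bool n)
  ws₀ = filterᵇ (g ∘ (false ∷_) ∘ toList) (words n)
  ws₁ = filterᵇ (g ∘ (true ∷_) ∘ toList) (words n)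

E-O≡signedCount : ∀ q n → + E q n - + O q n ≡ signedCount (leading q) n
E-O≡signedCount q n = sym (signedCount≡balance (leading q) n)

signedCount-cong : ∀ {g h} → (∀ w → g w ≡ h w) → ∀ n → signedCount g n ≡ signedCount h n
signedCount-cong g≗h zero    = cong (if_then 1ℤ else 0ℤ) (g≗h [])
signedCount-cong g≗h (suc n) = cong₂ _-_ (signedCount-cong (g≗h ∘ (false ∷_)) n)
                                         (signedCount-cong (g≗h ∘ (true ∷_)) n)

signedCount-reject : ∀ {g} → (∀ w → g w ≡ false) → ∀ n → signedCount g n ≡ 0ℤ
signedCount-reject g≗false zero    = cong (if_then 1ℤ else 0ℤ) (g≗false [])
signedCount-reject g≗false (suc n) = cong₂ _-_ (signedCount-reject (g≗false ∘ (false ∷_)) n)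
                                               (signedCount-reject (g≗false ∘ (true ∷_)) n)

-- ρ_k(n) = pulse q k n = (-1)^(n ∸ k) if k ≤ n and n ≡ k (mod q + 2), and 0 otherwise.
pulse : ℕ → ℕ → ℕ → ℤ
pulse q zero    zero    = 1ℤ
pulse q (suc k) zero    = 0ℤ
pulse q zero    (suc n) = - pulse q (suc q) n
pulse q (suc k) (suc n) = - pulse q k n

pulsePair : ℕ → ℕ → ℕ → ℤ
pulsePair q k n = pulse q k n + pulse q (suc k ℕ.+ q) n

∣-i∣+∣-j∣≡∣i∣+∣j∣ : ∀ i j → ∣ - i ∣ ℕ.+ ∣ - j ∣ ≡ ∣ i ∣ ℕ.+ ∣ j ∣
∣-i∣+∣-j∣≡∣i∣+∣j∣ i j = cong₂ ℕ._+_ (ℤₚ.∣-i∣≡∣i∣ i) (ℤₚ.∣-i∣≡∣i∣ j)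

pulse-disjoint : ∀ q n i j → i ≤ suc q → j ≤ suc q → i ≢ j → ∣ pulse q i n ∣ ℕ.+ ∣ pulse q j n ∣ ≤ 1
pulse-disjoint q zero    zero    zero    _         _         i≢j = ⊥-elim (i≢j refl)
pulse-disjoint q zero    zero    (suc j) _         _         _   = ℕₚ.≤-refl
pulse-disjoint q zero    (suc i) zero    _         _         _   = ℕₚ.≤-refl
pulse-disjoint q zero    (suc i) (suc j) _         _         _   = z≤n
pulse-disjoint q (suc n) zero    zero    _         _         i≢j = ⊥-elim (i≢j refl)
pulse-disjoint q (suc n) zero    (suc j) _         (s≤s j≤q) _   =
  subst (ℕ._≤ 1) (sym (∣-i∣+∣-j∣≡∣i∣+∣j∣ (pulse q (suc q) n) (pulse q j n)))
    (pulse-disjoint q n (suc q) j ℕₚ.≤-refl (ℕₚ.m≤n⇒m≤1+n j≤q) (ℕₚ.<⇒≢ (s≤s j≤q) ∘ sym))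
pulse-disjoint q (suc n) (suc i) zero    (s≤s i≤q) _         _   =
  subst (ℕ._≤ 1) (sym (∣-i∣+∣-j∣≡∣i∣+∣j∣ (pulse q i n) (pulse q (suc q) n)))
    (pulse-disjoint q n i (suc q) (ℕₚ.m≤n⇒m≤1+n i≤q) ℕₚ.≤-refl (ℕₚ.<⇒≢ (s≤s i≤q)))
pulse-disjoint q (suc n) (suc i) (suc j) (s≤s i≤q) (s≤s j≤q) i≢j =
  subst (ℕ._≤ 1) (sym (∣-i∣+∣-j∣≡∣i∣+∣j∣ (pulse q i n) (pulse q j n)))
    (pulse-disjoint q n i j (ℕₚ.m≤n⇒m≤1+n i≤q) (ℕₚ.m≤n⇒m≤1+n j≤q) (i≢j ∘ cong suc))

<⇒<ᵇ≡true : ∀ {m n} → m < n → (m <ᵇ n) ≡ true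
<⇒<ᵇ≡true m<n = Equivalence.to T-≡ (ℕₚ.<⇒<ᵇ m<n)

≤⇒<ᵇ≡false : ∀ {m n} → n ≤ m → (m <ᵇ n) ≡ false
≤⇒<ᵇ≡false z≤n       = refl
≤⇒<ᵇ≡false (s≤s n≤m) = ≤⇒<ᵇ≡false n≤m

≡+suc⇒<ᵇ≡true : ∀ {m b c} → m ≡ b ℕ.+ suc c → (b <ᵇ m) ≡ true
≡+suc⇒<ᵇ≡true {b = b} m≡b+1+c = <⇒<ᵇ≡true (subst (b <_) (sym m≡b+1+c) (ℕₚ.m<m+n b z<s))

ones-overdrawn : ∀ q a b → q * a ≤ b → ∀ w → ones q a b w ≡ false
ones-overdrawn q a b qa≤b []          = ≤⇒<ᵇ≡false qa≤b
ones-overdrawn q a b qa≤b (true ∷ w)  = ones-overdrawn q a (suc b) (ℕₚ.m≤n⇒m≤1+n qa≤b) w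
ones-overdrawn q a b qa≤b (false ∷ w) = cong (_∧ zeros q 1 w) (≤⇒<ᵇ≡false qa≤b)

module _ (p : ℕ) where
  private
    q : ℕ
    q = suc p

  mutual
    signedCount-zeros : ∀ a c n → q * a ≡ suc c →
      signedCount (zeros q a) n ≡ pulse q 0 n - pulse q (suc c) n
    signedCount-zeros a c zero    qa≡1+c = cong (λ m → if 0 <ᵇ m then 1ℤ else 0ℤ) qa≡1+c
    signedCount-zeros a c (suc n) qa≡1+c = begin
      signedCount (zeros q (suc a)) n - signedCount (ones q a 1) n
        ≡⟨ cong₂ _-_ (signedCount-zeros (suc a) (c ℕ.+ q) n q[1+a]≡1+c+q) (signedCount-ones a 1 c n qa≡1+c) ⟩
      (pulse q 0 n - pulse q (suc c ℕ.+ q) n) - (pulsePair q 0 n - pulsePair q c n)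
        ≡⟨ cancel (pulse q 0 n) (pulse q (suc c ℕ.+ q) n) (pulse q (suc q) n) (pulse q c n) ⟩
      - pulse q (suc q) n - - pulse q c n ∎
      where
      q[1+a]≡1+c+q : q * suc a ≡ suc (c ℕ.+ q)
      q[1+a]≡1+c+q = trans (ℕₚ.*-suc q a) (trans (cong (q ℕ.+_) qa≡1+c) (ℕₚ.+-comm q (suc c)))
      cancel : ∀ x y z u → (x - y) - ((x + z) - (u + y)) ≡ - z - - u
      cancel = solve-∀

    signedCount-ones : ∀ a b c n → q * a ≡ b ℕ.+ c →
      signedCount (ones q a b) n ≡ pulsePair q 0 n - pulsePair q c n
    signedCount-ones a b zero n qa≡b+0 = begin
      signedCount (ones q a b) n          ≡⟨ signedCount-reject (ones-overdrawn q a b qa≤b) n ⟩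
      0ℤ                                  ≡⟨ sym (ℤₚ.+-inverseʳ (pulsePair q 0 n)) ⟩
      pulsePair q 0 n - pulsePair q 0 n ∎
      where
      qa≤b : q * a ≤ b
      qa≤b = ℕₚ.≤-reflexive (trans qa≡b+0 (ℕₚ.+-identityʳ b))
    signedCount-ones a b (suc c) zero    qa≡b+1+c = cong (if_then 1ℤ else 0ℤ) (≡+suc⇒<ᵇ≡true qa≡b+1+c)
    signedCount-ones a b (suc c) (suc n) qa≡b+1+c = begin
      signedCount (λ w → (b <ᵇ q * a) ∧ zeros q 1 w) n - signedCount (ones q a (suc b)) n
        ≡⟨ cong (_- signedCount (ones q a (suc b)) n)
                (signedCount-cong (λ w → cong (_∧ zeros q 1 w) (≡+suc⇒<ᵇ≡true qa≡b+1+c)) n) ⟩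
      signedCount (zeros q 1) n - signedCount (ones q a (suc b)) n
        ≡⟨ cong₂ _-_ (signedCount-zeros 1 p n (ℕₚ.*-identityʳ q))
                     (signedCount-ones a (suc b) c n (trans qa≡b+1+c (ℕₚ.+-suc b c))) ⟩
      (pulse q 0 n - pulse q q n) - (pulsePair q 0 n - pulsePair q c n)
        ≡⟨ cancel (pulse q 0 n) (pulse q q n) (pulse q (suc q) n) (pulse q c n) (pulse q (suc c ℕ.+ q) n) ⟩
      (- pulse q (suc q) n + - pulse q q n) - (- pulse q c n + - pulse q (suc c ℕ.+ q) n) ∎
      where
      cancel : ∀ x w z u v → (x - w) - ((x + z) - (u + v)) ≡ (- z + - w) - (- u + - v)
      cancel = solve-∀

  signedCount-leading : ∀ n → signedCount (leading q) n ≡ pulsePair q 0 n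
  signedCount-leading zero    = refl
  signedCount-leading (suc n) = begin
    signedCount (zeros q 1) n - signedCount (leading q) n
      ≡⟨ cong₂ _-_ (signedCount-zeros 1 p n (ℕₚ.*-identityʳ q)) (signedCount-leading n) ⟩
    (pulse q 0 n - pulse q q n) - (pulse q 0 n + pulse q (suc q) n)
      ≡⟨ cancel (pulse q 0 n) (pulse q q n) (pulse q (suc q) n) ⟩
    - pulse q (suc q) n + - pulse q q n ∎
    where
    cancel : ∀ x w z → (x - w) - (x + z) ≡ - z + - w
    cancel = solve-∀

pulsePair-bounded : ∀ q n → ∣ pulsePair q 0 n ∣ ≤ 1
pulsePair-bounded q n = ℕₚ.≤-trans (ℤₚ.∣i+j∣≤∣i∣+∣j∣ (pulse q 0 n) (pulse q (suc q) n))
                                   (pulse-disjoint q n 0 (suc q) z≤n ℕₚ.≤-refl (λ ()))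

∣i∣≤1⇒i∈[-1,1] : ∀ i → ∣ i ∣ ≤ 1 → (i ≡ -[1+ 0 ]) ⊎ (i ≡ + 0) ⊎ (i ≡ + 1)
∣i∣≤1⇒i∈[-1,1] (+ 0)              _               = inj₂ (inj₁ refl)
∣i∣≤1⇒i∈[-1,1] (+ 1)              _               = inj₂ (inj₂ refl)
∣i∣≤1⇒i∈[-1,1] (+ suc (suc _))    (s≤s ())
∣i∣≤1⇒i∈[-1,1] -[1+ 0 ]           _               = inj₁ refl
∣i∣≤1⇒i∈[-1,1] -[1+ suc _ ]       (s≤s ())

corollary1 : (n q : ℕ) → q ≥ 1 →
    ((+ E q n) - (+ O q n) ≡ -[1+ 0 ]) ⊎ ((+ E q n) - (+ O q n) ≡ + 0) ⊎ ((+ E q n) - (+ O q n) ≡ + 1)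
corollary1 n (suc p) _ = ∣i∣≤1⇒i∈[-1,1] (+ E (suc p) n - + O (suc p) n)
  (subst (λ i → ∣ i ∣ ≤ 1) (sym E-O≡pulsePair) (pulsePair-bounded (suc p) n))
  where
  E-O≡pulsePair : + E (suc p) n - + O (suc p) n ≡ pulsePair (suc p) 0 n
  E-O≡pulsePair = trans (E-O≡signedCount (suc p) n) (signedCount-leading p n)
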